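{- If ${\rm DHL}^*(5;2)$ holds, then for every positive integer $k$ with $30\mid k$ the equation $\phi(n+k)=\phi(n)$ has infinitely many solutions $n\in\mathbb{N}$. If ${\rm DHL}^*(4;2)$ holds, then for every positive integer $k$ with $6\mid k$ the equation $\phi(n+k)=\phi(n)$ has infinitely many solutions $n\in\mathbb{N}$.
   Context: $\phi$ is Euler's totient function. A collection of linear forms $(a_1n+b_1,\ldots,a_Kn+b_K)$ with integer coefficients is called admissible if $a_i>0$ for each $i$, the forms are pairwise distinct, and there is no prime $p$ dividing the product $(a_1n+b_1)\cdots(a_Kn+b_K)$ for every integer $n$. For positive integers $K\ge m$, the statement ${\rm DHL}^*(K;m)$ means: for every admissible collection of $K$ linear forms $(a_1n+b_1,\ldots,a_Kn+b_K)$ there exist distinct indices $i_1,\ldots,i_m\in\{1,\ldots,K\}$ such that there are infinitely many integers $r$ for which the $m$ numbers $a_{i_1}r+b_{i_1},\ldots,a_{i_m}r+b_{i_m}$ are simultaneously prime. -}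

module Defs where

open import Data.Nat as ℕ using (ℕ; zero; suc; _≤_)
open import Data.Nat.GCD using (gcd)
open import Data.Nat.Primality using (Prime)
open import Data.List using (List; length; filter)
open import Data.List.Base using (upTo; map)
open import Data.Integer as ℤ using (ℤ; +_; _*_; _+_; ∣_∣; _>_; 0ℤ)
open import Data.Integer.Divisibility using (_∣_)
open import Data.Fin using (Fin) renaming (zero to fzero; suc to fsuc)
open import Data.Product using (Σ; ∃; _×_; _,_)
open import Function.Definitions using (Injective)
open import Relation.Binary.PropositionalEquality using (_≡_; _≢_)
open import Relation.Nullary using (¬_)
open import Data.Nat using (_≟_)

-- Euler's totient: φ n = #{ k : 1 ≤ k ≤ n , gcd k n = 1 }  (so φ 0 = 0)
φ : ℕ → ℕ
φ n = length (filter (λ k → gcd (suc k) n ≟ 1) (upTo n))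

prodFin : (K : ℕ) → (Fin K → ℤ) → ℤ
prodFin zero    f = ℤ.+ 1
prodFin (suc K) f = f fzero * prodFin K (λ i → f (fsuc i))

IsPrimeℤ : ℤ → Set
IsPrimeℤ z = Σ ℕ λ p → Prime p × (z ≡ + p)

Admissible : (K : ℕ) → (a b : Fin K → ℤ) → Set
Admissible K a b =
  ((i : Fin K) → a i > 0ℤ)
  × ((i j : Fin K) → i ≢ j → ¬ (a i ≡ a j × b i ≡ b j))
  × ((p : ℕ) → Prime p → ¬ ((n : ℤ) → + p ∣ prodFin K (λ i → a i * n + b i)))

DHL* : ℕ → ℕ → Set
DHL* K m = (a b : Fin K → ℤ) → Admissible K a b →
  Σ (Fin m → Fin K) λ ι → Injective _≡_ _≡_ ι ×
    ((N : ℕ) → Σ ℤ λ r → (N ≤ ∣ r ∣) × ((j : Fin m) → IsPrimeℤ (a (ι j) * r + b (ι j))))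

InfManySolutions : ℕ → Set
InfManySolutions k = (N : ℕ) → Σ ℕ λ n → (N ≤ n) × (φ (n ℕ.+ k) ≡ φ n)

-- If s R + 1 and t R + 1 are both prime and c < d ≤ R satisfy d = c + k, t c = s d and
-- t φ(c) = s φ(d), then n = (t R + 1) c has n + k = (s R + 1) d and
-- φ(n) = t R φ(c) = s R φ(d) = φ(n + k).  DHL* applied to the forms a r + 1 with
-- a ∈ {1, 2, 3, 4, 6} (resp. {1, 2, 3, 4}) yields such a prime pair for some s < t with R
-- arbitrarily large.  For every such pair and every multiple k of 30 (resp. 6) one may take
-- c = s′ m, d = t′ m, where s′ : t′ is s : t in lowest terms and (t′ − s′) m = k: every prime
-- factor of s′ t′ then divides m, so φ(s′ m) = s′ φ(m) and φ(t′ m) = t′ φ(m).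
-- Both facts about φ are counts: φ(a m) = a φ(m) when the prime factors of a divide m, as
-- coprimality to a m and to m agree and is m-periodic; and φ(p m) = (p − 1) φ(m) for a prime
-- p ∤ m, as exactly φ(m) of the numbers in [1, p m] coprime to m are multiples of p.

module Submission where

open import Defs
open import Data.Nat using (ℕ; _<_)
open import Data.Nat.Divisibility using (_∣_)
open import Data.Product using (_×_)

open import Data.Bool using (T)
open import Data.Fin using (Fin; zero; suc; toℕ)
open import Data.Fin.Properties using (<-cmp; 0≢1+n; all?) renaming (_≟_ to _≟ᶠ_)
open import Data.Integer as ℤ using (ℤ; +_; -[1+_]; 0ℤ; _⊖_)
import Data.Integer.Properties as ℤ
open import Data.Integer.Divisibility using () renaming (_∣_ to _∣ℤ_)
open import Data.List using (length; filter)
open import Data.List.Base using (applyUpTo)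
open import Data.Nat using (zero; suc; _+_; _*_; _∸_; _≤_; _<ᵇ_; NonZero; z≤n; s≤s;
                           >-nonZero; >-nonZero⁻¹; ≢-nonZero⁻¹; nonTrivial⇒≢1)
open import Data.Nat.Coprimality using (Coprime; coprime?; coprime-+; coprime-divisor; prime⇒coprime;
                                        gcd≡1⇒coprime; coprime⇒gcd≡1) renaming (sym to coprime-sym)
open import Data.Nat.Divisibility
  using (divides; _∣?_; ∣-trans; n∣m*n; m∣m*n; ∣m∣n⇒∣m+n; ∣m+n∣m⇒∣n; ∣⇒≤; ∣1⇒≡1)
open import Data.Nat.GCD using (gcd)
open import Data.Nat.Primality using (Prime; prime⇒irreducible; prime⇒nonTrivial; prime⇒nonZero)
open import Data.Nat.Properties
  using (_≟_; _<?_; +-comm; +-assoc; +-suc; +-identityʳ; *-comm; *-assoc; *-zeroʳ; *-identityˡ; *-identityʳ;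
         *-distribʳ-∸; m+n∸n≡m; ≤-trans; <-≤-trans; <⇒≱; <⇒<ᵇ; m≤m+n; m≤n+m; m≤m*n; m≤n*m;
         m*n≢0; m*n≢0⇒m≢0; +-commutativeSemigroup; module ≤-Reasoning)
open import Algebra.Properties.CommutativeSemigroup +-commutativeSemigroup using (interchange)
open import Data.Nat.Tactic.RingSolver using (solve-∀)
open import Data.Product using (Σ; _,_)
open import Data.Sum using (inj₁; inj₂)
open import Data.Vec using (_∷_; []; lookup)
open import Function using (_∘_; id)
open import Level using (Level)
open import Relation.Binary using (tri<; tri≈; tri>)
open import Relation.Binary.PropositionalEquality
open import Relation.Nullary using (¬_; Dec; yes; no; contradiction)
open import Relation.Nullary.Decidable using (True; toWitness; _→-dec_)
open import Relation.Unary using (Pred; Decidable)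

private variable
  ℓ ℓ′ : Level
  P : Set ℓ
  Q : Set ℓ′

𝟙 : Dec P → ℕ
𝟙 (yes _) = 1
𝟙 (no _)  = 0

𝟙-yes : (P? : Dec P) → P → 𝟙 P? ≡ 1
𝟙-yes (yes _) _  = refl
𝟙-yes (no ¬p) p = contradiction p ¬p

𝟙-no : (P? : Dec P) → ¬ P → 𝟙 P? ≡ 0
𝟙-no (yes p) ¬p = contradiction p ¬p
𝟙-no (no _)  _  = refl

𝟙-cong : (P? : Dec P) (Q? : Dec Q) → (P → Q) → (Q → P) → 𝟙 P? ≡ 𝟙 Q?
𝟙-cong (yes p) Q? P⇒Q Q⇒P = sym (𝟙-yes Q? (P⇒Q p))
𝟙-cong (no ¬p) Q? P⇒Q Q⇒P = sym (𝟙-no Q? (¬p ∘ Q⇒P))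

∑ : ℕ → (ℕ → ℕ) → ℕ
∑ zero    f = 0
∑ (suc n) f = f 0 + ∑ n (f ∘ suc)

syntax ∑ n (λ k → e) = ∑[ k < n ] e

∑-cong : ∀ {f g : ℕ → ℕ} n → (∀ k → f k ≡ g k) → ∑ n f ≡ ∑ n g
∑-cong zero    f≗g = refl
∑-cong (suc n) f≗g = cong₂ _+_ (f≗g 0) (∑-cong n (f≗g ∘ suc))

∑-+ : ∀ (f g : ℕ → ℕ) n → ∑[ k < n ] (f k + g k) ≡ ∑ n f + ∑ n g
∑-+ f g zero    = refl
∑-+ f g (suc n) = trans (cong (_+_ (f 0 + g 0)) (∑-+ (f ∘ suc) (g ∘ suc) n)) (interchange (f 0) (g 0) _ _)

∑-++ : ∀ (f : ℕ → ℕ) m n → ∑ (m + n) f ≡ ∑ m f + ∑[ k < n ] f (m + k)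
∑-++ f zero    n = refl
∑-++ f (suc m) n = trans (cong (_+_ (f 0)) (∑-++ (f ∘ suc) m n)) (sym (+-assoc (f 0) _ _))

∑-periodic : ∀ (f : ℕ → ℕ) n → (∀ k → f (n + k) ≡ f k) → ∀ a → ∑ (a * n) f ≡ a * ∑ n f
∑-periodic f n per zero    = refl
∑-periodic f n per (suc a) = trans (∑-++ f n (a * n))
  (cong (_+_ (∑ n f)) (trans (∑-cong (a * n) per) (∑-periodic f n per a)))

∑-blocks : ∀ (f : ℕ → ℕ) p n → ∑ (n * p) f ≡ ∑[ j < n ] ∑[ i < p ] f (j * p + i)
∑-blocks f p zero    = refl
∑-blocks f p (suc n) = trans (∑-++ f p (n * p)) (cong (_+_ (∑ p f)) (trans (∑-blocks (λ k → f (p + k)) p n)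
  (∑-cong n λ j → ∑-cong p λ i → cong f (sym (+-assoc p (j * p) i)))))

∑-last : ∀ (f : ℕ → ℕ) q → (∀ i → i < q → f i ≡ 0) → ∑ (suc q) f ≡ f q
∑-last f zero    _     = +-identityʳ (f 0)
∑-last f (suc q) f<q≡0 = trans (cong (_+ ∑ (suc q) (f ∘ suc)) (f<q≡0 0 (s≤s z≤n)))
  (∑-last (f ∘ suc) q λ i i<q → f<q≡0 (suc i) (s≤s i<q))

length-filter-applyUpTo : {P : Pred ℕ ℓ} (P? : Decidable P) (f : ℕ → ℕ) (n : ℕ) →
                          length (filter P? (applyUpTo f n)) ≡ ∑[ k < n ] 𝟙 (P? (f k))
length-filter-applyUpTo P? f zero = refl
length-filter-applyUpTo P? f (suc n) with P? (f 0)
... | yes _ = cong suc (length-filter-applyUpTo P? (f ∘ suc) n)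
... | no  _ = length-filter-applyUpTo P? (f ∘ suc) n

coprime-∣ʳ : ∀ {x m n} → Coprime x n → m ∣ n → Coprime x m
coprime-∣ʳ c m∣n (d∣x , d∣m) = c (d∣x , ∣-trans d∣m m∣n)

coprime-*ʳ : ∀ {x m n} → Coprime x m → Coprime x n → Coprime x (m * n)
coprime-*ʳ c₁ c₂ (d∣x , d∣mn) = c₂ (d∣x , coprime-divisor (λ (e∣d , e∣m) → c₁ (∣-trans e∣d d∣x , e∣m)) d∣mn)

coprime-∣ˡ : ∀ {x m n} → Coprime x n → m ∣ x → Coprime m n
coprime-∣ˡ c m∣x = coprime-sym (coprime-∣ʳ (coprime-sym c) m∣x)

coprime-*ˡ : ∀ {m n x} → Coprime m x → Coprime n x → Coprime (m * n) x
coprime-*ˡ c₁ c₂ = coprime-sym (coprime-*ʳ (coprime-sym c₁) (coprime-sym c₂))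

coprime-+⁻¹ : ∀ {m n} → Coprime (n + m) n → Coprime m n
coprime-+⁻¹ c (d∣m , d∣n) = c (∣m∣n⇒∣m+n d∣n d∣m , d∣n)

prime∤⇒coprime : ∀ {p x} → Prime p → ¬ p ∣ x → Coprime p x
prime∤⇒coprime pp p∤x (d∣p , d∣x) with prime⇒irreducible pp d∣p
... | inj₁ d≡1 = d≡1
... | inj₂ refl = contradiction d∣x p∤x

coprimeCount : ℕ → ℕ → ℕ
coprimeCount n L = ∑[ k < L ] 𝟙 (coprime? (suc k) n)

φ≡coprimeCount : ∀ n → φ n ≡ coprimeCount n n
φ≡coprimeCount n = trans (length-filter-applyUpTo (λ k → gcd (suc k) n ≟ 1) id n)
  (∑-cong n λ _ → 𝟙-cong _ _ gcd≡1⇒coprime coprime⇒gcd≡1)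

coprimeCount-cong : ∀ {m n} → (∀ {x} → Coprime x m → Coprime x n) → (∀ {x} → Coprime x n → Coprime x m) →
                    ∀ L → coprimeCount m L ≡ coprimeCount n L
coprimeCount-cong m⇒n n⇒m L = ∑-cong L λ _ → 𝟙-cong _ _ m⇒n n⇒m

coprimeCount-multiple : ∀ a n → coprimeCount n (a * n) ≡ a * φ n
coprimeCount-multiple a n = trans (∑-periodic _ n shift a) (cong (a *_) (sym (φ≡coprimeCount n)))
  where
  shift : ∀ k → 𝟙 (coprime? (suc (n + k)) n) ≡ 𝟙 (coprime? (suc k) n)
  shift k = trans (cong (λ x → 𝟙 (coprime? x n)) (sym (+-suc n k))) (𝟙-cong _ _ coprime-+⁻¹ coprime-+)

φ-* : ∀ {a n} → (∀ {x} → Coprime x n → Coprime x a) → φ (a * n) ≡ a * φ n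
φ-* {a} {n} coprime-a = begin
  φ (a * n)                    ≡⟨ φ≡coprimeCount (a * n) ⟩
  coprimeCount (a * n) (a * n) ≡⟨ coprimeCount-cong (λ c → coprime-∣ʳ c (n∣m*n a))
                                                     (λ c → coprime-*ʳ (coprime-a c) c) (a * n) ⟩
  coprimeCount n (a * n)       ≡⟨ coprimeCount-multiple a n ⟩
  a * φ n                      ∎
  where open ≡-Reasoning

coprime-multiples : ∀ p {n} .{{_ : NonZero p}} → Coprime p n →
                    ∑[ k < p * n ] (𝟙 (coprime? (suc k) n) * 𝟙 (p ∣? suc k)) ≡ φ n
coprime-multiples p@(suc q) {n} p⊥n = begin
  ∑ (p * n) g                          ≡⟨ cong (λ L → ∑ L g) (*-comm p n) ⟩
  ∑ (n * p) g                          ≡⟨ ∑-blocks g p n ⟩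
  ∑[ j < n ] ∑[ i < p ] g (j * p + i)  ≡⟨ ∑-cong n block ⟩
  coprimeCount n n                     ≡⟨ φ≡coprimeCount n ⟨
  φ n                                  ∎
  where
  open ≡-Reasoning
  g : ℕ → ℕ
  g k = 𝟙 (coprime? (suc k) n) * 𝟙 (p ∣? suc k)

  g-vanishes : ∀ j i → i < q → g (j * p + i) ≡ 0
  g-vanishes j i i<q = trans (cong (𝟙 (coprime? (suc (j * p + i)) n) *_) (𝟙-no (p ∣? _) p∤))
                             (*-zeroʳ (𝟙 (coprime? (suc (j * p + i)) n)))
    where
    p∤ : ¬ p ∣ suc (j * p + i)
    p∤ p∣ = <⇒≱ (s≤s i<q) (∣⇒≤ (∣m+n∣m⇒∣n (subst (p ∣_) (sym (+-suc (j * p) i)) p∣) (n∣m*n j)))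

  block : ∀ j → ∑[ i < p ] g (j * p + i) ≡ 𝟙 (coprime? (suc j) n)
  block j = begin
    ∑[ i < p ] g (j * p + i)                         ≡⟨ ∑-last _ q (g-vanishes j) ⟩
    g (j * p + q)                                    ≡⟨ cong (λ x → 𝟙 (coprime? x n) * 𝟙 (p ∣? x)) (cong suc (+-comm (j * p) q)) ⟩
    𝟙 (coprime? (suc j * p) n) * 𝟙 (p ∣? suc j * p) ≡⟨ cong (𝟙 (coprime? (suc j * p) n) *_) (𝟙-yes (p ∣? _) (n∣m*n (suc j))) ⟩
    𝟙 (coprime? (suc j * p) n) * 1                   ≡⟨ *-identityʳ _ ⟩
    𝟙 (coprime? (suc j * p) n)                       ≡⟨ 𝟙-cong (coprime? _ n) (coprime? _ n)
                                                          (λ c → coprime-∣ˡ c (m∣m*n p)) (λ c → coprime-*ˡ c p⊥n) ⟩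
    𝟙 (coprime? (suc j) n)                           ∎

module _ {p n : ℕ} (p-prime : Prime p) where

  𝟙-coprime-*-prime : ∀ x → 𝟙 (coprime? x (p * n)) + 𝟙 (coprime? x n) * 𝟙 (p ∣? x) ≡ 𝟙 (coprime? x n)
  𝟙-coprime-*-prime x with coprime? x n | p ∣? x
  ... | yes c | yes p∣x = cong (_+ 1) (𝟙-no (coprime? x (p * n)) λ c′ →
                            nonTrivial⇒≢1 {{prime⇒nonTrivial p-prime}} (c′ (p∣x , m∣m*n n)))
  ... | yes c | no  p∤x = cong (_+ 0) (𝟙-yes (coprime? x (p * n))
                            (coprime-*ʳ (coprime-sym (prime∤⇒coprime p-prime p∤x)) c))
  ... | no ¬c | _       = cong (_+ 0) (𝟙-no (coprime? x (p * n)) λ c′ → ¬c (coprime-∣ʳ c′ (n∣m*n p)))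

  φ-*-prime-+ : Coprime p n → φ (p * n) + φ n ≡ p * φ n
  φ-*-prime-+ p⊥n = begin
    φ (p * n) + φ n                                    ≡⟨ cong₂ _+_ (φ≡coprimeCount (p * n)) (sym (coprime-multiples p p⊥n)) ⟩
    coprimeCount (p * n) (p * n) + ∑ (p * n) multiple ≡⟨ ∑-+ _ multiple (p * n) ⟨
    ∑[ k < p * n ] (𝟙 (coprime? (suc k) (p * n)) + multiple k) ≡⟨ ∑-cong (p * n) (𝟙-coprime-*-prime ∘ suc) ⟩
    coprimeCount n (p * n)                             ≡⟨ coprimeCount-multiple p n ⟩
    p * φ n                                            ∎
    where
    open ≡-Reasoning
    instance _ = prime⇒nonZero p-prime
    multiple : ℕ → ℕ
    multiple k = 𝟙 (coprime? (suc k) n) * 𝟙 (p ∣? suc k)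

  φ-*-prime : Coprime p n → φ (p * n) ≡ (p ∸ 1) * φ n
  φ-*-prime p⊥n = begin
    φ (p * n)              ≡⟨ m+n∸n≡m (φ (p * n)) (φ n) ⟨
    φ (p * n) + φ n ∸ φ n  ≡⟨ cong (_∸ φ n) (φ-*-prime-+ p⊥n) ⟩
    p * φ n ∸ φ n          ≡⟨ cong (p * φ n ∸_) (*-identityˡ (φ n)) ⟨
    p * φ n ∸ 1 * φ n      ≡⟨ *-distribʳ-∸ (φ n) p 1 ⟨
    (p ∸ 1) * φ n          ∎
    where open ≡-Reasoning

record Template (s t k : ℕ) : Set where
  field
    c d       : ℕ
    {{c≢0}}   : NonZero c
    c+k≡d     : c + k ≡ d
    t*c≡s*d   : t * c ≡ s * d
    t*φc≡s*φd : t * φ c ≡ s * φ d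

φ-*-prime-form : ∀ a R c .{{_ : NonZero a}} .{{_ : NonZero c}} → Prime (a * R + 1) → c ≤ R →
                 φ ((a * R + 1) * c) ≡ R * (a * φ c)
φ-*-prime-form a R c p-prime c≤R = begin
  φ ((a * R + 1) * c)      ≡⟨ φ-*-prime p-prime (prime⇒coprime p-prime c<p) ⟩
  (a * R + 1 ∸ 1) * φ c    ≡⟨ cong (_* φ c) (m+n∸n≡m (a * R) 1) ⟩
  a * R * φ c              ≡⟨ cong (_* φ c) (*-comm a R) ⟩
  R * a * φ c              ≡⟨ *-assoc R a (φ c) ⟩
  R * (a * φ c)            ∎
  where
  open ≡-Reasoning
  c<p : c < a * R + 1
  c<p = subst (c <_) (+-comm 1 (a * R)) (s≤s (≤-trans c≤R (m≤n*m R a)))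

module _ {s t k : ℕ} .{{_ : NonZero s}} .{{_ : NonZero t}} (T : Template s t k) where
  open Template T

  c≤d : c ≤ d
  c≤d = subst (c ≤_) c+k≡d (m≤m+n c k)

  template-solution : ∀ {R} → Prime (s * R + 1) → Prime (t * R + 1) → d ≤ R →
                      φ ((t * R + 1) * c + k) ≡ φ ((t * R + 1) * c)
  template-solution {R} p-prime q-prime d≤R = begin
    φ ((t * R + 1) * c + k)  ≡⟨ cong φ shifted ⟩
    φ ((s * R + 1) * d)      ≡⟨ φ-*-prime-form s R d p-prime d≤R ⟩
    R * (s * φ d)            ≡⟨ cong (R *_) t*φc≡s*φd ⟨
    R * (t * φ c)            ≡⟨ φ-*-prime-form t R c q-prime (≤-trans c≤d d≤R) ⟨
    φ ((t * R + 1) * c)      ∎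
    where
    open ≡-Reasoning
    instance _ = >-nonZero (<-≤-trans (>-nonZero⁻¹ c) c≤d)
    expand : ∀ t R c k → (t * R + 1) * c + k ≡ R * (t * c) + (c + k)
    expand = solve-∀
    factor : ∀ s R d → R * (s * d) + d ≡ (s * R + 1) * d
    factor = solve-∀
    shifted : (t * R + 1) * c + k ≡ (s * R + 1) * d
    shifted = begin
      (t * R + 1) * c + k    ≡⟨ expand t R c k ⟩
      R * (t * c) + (c + k)  ≡⟨ cong₂ (λ x y → R * x + y) t*c≡s*d c+k≡d ⟩
      R * (s * d) + d        ≡⟨ factor s R d ⟩
      (s * R + 1) * d        ∎

InfinitelyManyPrimePairs : ℕ → ℕ → Set
InfinitelyManyPrimePairs s t = ∀ N → Σ ℕ λ R → N ≤ R × Prime (s * R + 1) × Prime (t * R + 1)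

InfinitelyManyPrimePairs-swap : ∀ {s t} → InfinitelyManyPrimePairs s t → InfinitelyManyPrimePairs t s
InfinitelyManyPrimePairs-swap pairs N with pairs N
... | R , N≤R , p-prime , q-prime = R , N≤R , q-prime , p-prime

template⇒InfManySolutions : ∀ {s t k} .{{_ : NonZero s}} .{{_ : NonZero t}} → Template s t k →
                            InfinitelyManyPrimePairs s t → InfManySolutions k
template⇒InfManySolutions {t = t} T pairs N with pairs (N + Template.d T)
... | R , N+d≤R , p-prime , q-prime =
  (t * R + 1) * c , N≤n , template-solution T p-prime q-prime (≤-trans (m≤n+m d N) N+d≤R)
  where
  open Template T
  open ≤-Reasoning
  N≤n : N ≤ (t * R + 1) * c
  N≤n = begin
    N                  ≤⟨ ≤-trans (m≤m+n N d) N+d≤R ⟩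
    R                  ≤⟨ m≤n*m R t ⟩
    t * R              ≤⟨ m≤m+n (t * R) 1 ⟩
    t * R + 1          ≤⟨ m≤m*n (t * R + 1) c ⟩
    (t * R + 1) * c    ∎

prodFin-at-0 : ∀ K (a : Fin K → ℤ) → prodFin K (λ i → a i ℤ.* 0ℤ ℤ.+ + 1) ≡ + 1
prodFin-at-0 zero    a = refl
prodFin-at-0 (suc K) a = cong₂ ℤ._*_ (cong (ℤ._+ + 1) (ℤ.*-zeroʳ (a zero))) (prodFin-at-0 K (a ∘ suc))

unit-forms-admissible : ∀ {K} (a : Fin K → ℕ) → (∀ i → NonZero (a i)) → (∀ {i j} → a i ≡ a j → i ≡ j) →
                        Admissible K (λ i → + a i) (λ _ → + 1)
unit-forms-admissible {K} a a≢0 a-injective = positive , distinct , no-fixed-prime-divisor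
  where
  positive : ∀ i → + a i ℤ.> 0ℤ
  positive i = ℤ.+<+ (>-nonZero⁻¹ (a i) {{a≢0 i}})
  distinct : ∀ i j → i ≢ j → ¬ (+ a i ≡ + a j × + 1 ≡ + 1)
  distinct i j i≢j (ai≡aj , _) = i≢j (a-injective (ℤ.+-injective ai≡aj))
  no-fixed-prime-divisor : ∀ p → Prime p → ¬ (∀ n → + p ∣ℤ prodFin K (λ i → + a i ℤ.* n ℤ.+ + 1))
  no-fixed-prime-divisor p p-prime p∣values = nonTrivial⇒≢1 {{prime⇒nonTrivial p-prime}}
    (∣1⇒≡1 (subst (+ p ∣ℤ_) (prodFin-at-0 K (λ i → + a i)) (p∣values 0ℤ)))

prime-value-nonNegative : ∀ s r .{{_ : NonZero s}} → IsPrimeℤ (+ s ℤ.* r ℤ.+ + 1) → Σ ℕ λ R → r ≡ + R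
prime-value-nonNegative (suc s) (+ R)    _                    = R , refl
prime-value-nonNegative (suc s) -[1+ x ] (p , p-prime , value≡p) =
  contradiction (1⊖1+m≡+p⇒p≡0 (x + s * suc x) value≡p) (≢-nonZero⁻¹ p {{prime⇒nonZero p-prime}})
  where
  1⊖1+m≡+p⇒p≡0 : ∀ m {p} → 1 ⊖ suc m ≡ + p → p ≡ 0
  1⊖1+m≡+p⇒p≡0 zero    refl = refl
  1⊖1+m≡+p⇒p≡0 (suc m) ()

prime-value : ∀ s R → IsPrimeℤ (+ s ℤ.* + R ℤ.+ + 1) → Prime (s * R + 1)
prime-value s R (p , p-prime , value≡p) =
  subst Prime (sym (ℤ.+-injective (trans (cong (ℤ._+ + 1) (ℤ.pos-* s R)) value≡p))) p-prime

DHL*⇒InfinitelyManyPrimePairs : ∀ {K} (a : Fin K → ℕ) → (∀ i → NonZero (a i)) → (∀ {i j} → a i ≡ a j → i ≡ j) →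
  DHL* K 2 → Σ (Fin K) λ i → Σ (Fin K) λ j → i ≢ j × InfinitelyManyPrimePairs (a i) (a j)
DHL*⇒InfinitelyManyPrimePairs a a≢0 a-injective dhl
  with dhl (λ i → + a i) (λ _ → + 1) (unit-forms-admissible a a≢0 a-injective)
... | ι , ι-injective , primes = ι zero , ι (suc zero) , (λ ι₀≡ι₁ → 0≢1+n (ι-injective ι₀≡ι₁)) , pairs
  where
  pairs : InfinitelyManyPrimePairs (a (ι zero)) (a (ι (suc zero)))
  pairs N with primes N
  ... | r , N≤∣r∣ , r-primes with prime-value-nonNegative (a (ι zero)) r {{a≢0 _}} (r-primes zero)
  ... | R , refl = R , N≤∣r∣ , prime-value (a (ι zero)) R (r-primes zero)
                            , prime-value (a (ι (suc zero))) R (r-primes (suc zero))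

-- The pair (i, j) is ordered by a Boolean test so that, in the tables of templates below, the
-- hypothesis of every omitted pair with i ≥ j computes to ⊥ and needs no clause.
DHL*⇒InfManySolutions : ∀ {K k} (a : Fin K → ℕ) → (∀ i → NonZero (a i)) → (∀ {i j} → a i ≡ a j → i ≡ j) →
  (∀ i j → T (toℕ i <ᵇ toℕ j) → Template (a i) (a j) k) → DHL* K 2 → InfManySolutions k
DHL*⇒InfManySolutions a a≢0 a-injective templates dhl with DHL*⇒InfinitelyManyPrimePairs a a≢0 a-injective dhl
... | i , j , i≢j , pairs with <-cmp i j
... | tri< i<j _ _ = template⇒InfManySolutions {{a≢0 i}} {{a≢0 j}} (templates i j (<⇒<ᵇ i<j)) pairs
... | tri≈ _ i≡j _ = contradiction i≡j i≢j
... | tri> _ _ j<i = template⇒InfManySolutions {{a≢0 j}} {{a≢0 i}} (templates j i (<⇒<ᵇ j<i))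
                       (InfinitelyManyPrimePairs-swap {a i} {a j} pairs)

module _ {K : ℕ} (a : Fin K → ℕ) where

  decide-nonZero : {True (all? λ i → 0 <? a i)} → ∀ i → NonZero (a i)
  decide-nonZero {positive} i = >-nonZero (toWitness positive i)

  decide-injective : {True (all? λ i → all? λ j → (a i ≟ a j) →-dec (i ≟ᶠ j))} → ∀ {i j} → a i ≡ a j → i ≡ j
  decide-injective {distinct} {i} {j} = toWitness distinct i j

-- c = s′ q e and d = t′ q e; the divisibility side conditions put the prime factors of s′ and t′ into q e.
template : ∀ {s t} k₀ s′ t′ e .{{_ : NonZero s′}} .{{_ : NonZero e}} →
           {True (t * s′ ≟ s * t′)} → {True (s′ * e + k₀ ≟ t′ * e)} →
           {True (s′ ∣? e * e)} → {True (t′ ∣? e * e)} →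
           ∀ q .{{_ : NonZero q}} → Template s t (q * k₀)
template {s} {t} k₀ s′ t′ e {cross} {gap} {s′∣e²} {t′∣e²} q = record
  { c         = s′ * m
  ; d         = t′ * m
  ; c≢0       = m*n≢0 s′ m
  ; c+k≡d     = c+k≡d
  ; t*c≡s*d   = cross-* m
  ; t*φc≡s*φd = begin
      t * φ (s′ * m)    ≡⟨ cong (t *_) (φ-* (coprime-to-divisor-of-square s′∣e²)) ⟩
      t * (s′ * φ m)    ≡⟨ cross-* (φ m) ⟩
      s * (t′ * φ m)    ≡⟨ cong (s *_) (φ-* (coprime-to-divisor-of-square t′∣e²)) ⟨
      s * φ (t′ * m)    ∎
  }
  where
  open ≡-Reasoning
  m : ℕ
  m = q * e
  instance
    m≢0 : NonZero m
    m≢0 = m*n≢0 q e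

  cross-* : ∀ x → t * (s′ * x) ≡ s * (t′ * x)
  cross-* x = begin
    t * (s′ * x)  ≡⟨ *-assoc t s′ x ⟨
    t * s′ * x    ≡⟨ cong (_* x) (toWitness cross) ⟩
    s * t′ * x    ≡⟨ *-assoc s t′ x ⟩
    s * (t′ * x)  ∎

  coprime-to-divisor-of-square : ∀ {b} → True (b ∣? e * e) → ∀ {x} → Coprime x m → Coprime x b
  coprime-to-divisor-of-square b∣e² x⊥m = coprime-∣ʳ (coprime-*ʳ x⊥e x⊥e) (toWitness b∣e²)
    where x⊥e = coprime-∣ʳ x⊥m (n∣m*n q)

  c+k≡d : s′ * m + q * k₀ ≡ t′ * m
  c+k≡d = begin
    s′ * (q * e) + q * k₀  ≡⟨ collect s′ q e k₀ ⟩
    q * (s′ * e + k₀)      ≡⟨ cong (q *_) (toWitness gap) ⟩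
    q * (t′ * e)           ≡⟨ spread q t′ e ⟩
    t′ * (q * e)           ∎
    where
    collect : ∀ s′ q e k₀ → s′ * (q * e) + q * k₀ ≡ q * (s′ * e + k₀)
    collect = solve-∀
    spread : ∀ q t′ e → q * (t′ * e) ≡ t′ * (q * e)
    spread = solve-∀

DHL*⇒InfManySolutions-multiples : ∀ {K} k₀ (a : Fin K → ℕ) → (∀ i → NonZero (a i)) → (∀ {i j} → a i ≡ a j → i ≡ j) →
  (∀ q .{{_ : NonZero q}} i j → T (toℕ i <ᵇ toℕ j) → Template (a i) (a j) (q * k₀)) →
  DHL* K 2 → (k : ℕ) → 0 < k → k₀ ∣ k → InfManySolutions k
DHL*⇒InfManySolutions-multiples k₀ a a≢0 a-injective templates dhl k 0<k (divides q k≡q*k₀) =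
  subst InfManySolutions (sym k≡q*k₀) (DHL*⇒InfManySolutions a a≢0 a-injective (templates q {{q≢0}}) dhl)
  where
  q≢0 : NonZero q
  q≢0 = m*n≢0⇒m≢0 q {{subst NonZero k≡q*k₀ (>-nonZero 0<k)}}

forms₃₀ : Fin 5 → ℕ
forms₃₀ = lookup (1 ∷ 2 ∷ 3 ∷ 4 ∷ 6 ∷ [])

templates₃₀ : ∀ q .{{_ : NonZero q}} i j → T (toℕ i <ᵇ toℕ j) → Template (forms₃₀ i) (forms₃₀ j) (q * 30)
templates₃₀ q zero                (suc zero)                      _ = template 30 1 2 30 q
templates₃₀ q zero                (suc (suc zero))                _ = template 30 1 3 15 q
templates₃₀ q zero                (suc (suc (suc zero)))          _ = template 30 1 4 10 q
templates₃₀ q zero                (suc (suc (suc (suc zero))))    _ = template 30 1 6 6 q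
templates₃₀ q (suc zero)          (suc (suc zero))                _ = template 30 2 3 30 q
templates₃₀ q (suc zero)          (suc (suc (suc zero)))          _ = template 30 1 2 30 q
templates₃₀ q (suc zero)          (suc (suc (suc (suc zero))))    _ = template 30 1 3 15 q
templates₃₀ q (suc (suc zero))    (suc (suc (suc zero)))          _ = template 30 3 4 30 q
templates₃₀ q (suc (suc zero))    (suc (suc (suc (suc zero))))    _ = template 30 1 2 30 q
templates₃₀ q (suc (suc (suc zero))) (suc (suc (suc (suc zero)))) _ = template 30 2 3 30 q

forms₆ : Fin 4 → ℕ
forms₆ = lookup (1 ∷ 2 ∷ 3 ∷ 4 ∷ [])

templates₆ : ∀ q .{{_ : NonZero q}} i j → T (toℕ i <ᵇ toℕ j) → Template (forms₆ i) (forms₆ j) (q * 6)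
templates₆ q zero             (suc zero)             _ = template 6 1 2 6 q
templates₆ q zero             (suc (suc zero))       _ = template 6 1 3 3 q
templates₆ q zero             (suc (suc (suc zero))) _ = template 6 1 4 2 q
templates₆ q (suc zero)       (suc (suc zero))       _ = template 6 2 3 6 q
templates₆ q (suc zero)       (suc (suc (suc zero))) _ = template 6 1 2 6 q
templates₆ q (suc (suc zero)) (suc (suc (suc zero))) _ = template 6 3 4 6 q

theorem3 : (DHL* 5 2 → (k : ℕ) → 0 < k → 30 ∣ k → InfManySolutions k)
         × (DHL* 4 2 → (k : ℕ) → 0 < k → 6 ∣ k → InfManySolutions k)
theorem3 = DHL*⇒InfManySolutions-multiples 30 forms₃₀ (decide-nonZero forms₃₀) (decide-injective forms₃₀) templates₃₀
         , DHL*⇒InfManySolutions-multiples 6 forms₆ (decide-nonZero forms₆) (decide-injective forms₆) templates₆
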